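{- Let $d$ be a positive integer and let $z_j\in\mathbb{C}$ be given for each $j\in[d]$ relatively prime to $d$. Suppose that for every $m$ with $1\le m\le 6$ and every $m$-tuple $(j_1,\ldots,j_m)$ of elements of $[d]$ relatively prime to $d$ satisfying $j_1+\cdots+j_m\equiv 0\pmod d$, we have $z_{j_1}+\cdots+z_{j_m}\in\mathbb{Z}$. Then there exists an integer $c$ such that $z_j-\frac{cj}{d}\in\mathbb{Z}$ for all $j\in[d]$ relatively prime to $d$.
   Context: $[d]=\{1,\ldots,d\}$. -}

module Defs where

open import Level using (Level)
open import Data.Nat using (ℕ; zero; suc; _≤_; NonZero)
import Data.Nat as ℕ
open import Data.Nat.Coprimality using (Coprime)
open import Data.Fin using (Fin)
import Data.Fin as Fin
open import Data.Integer using (ℤ)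
import Data.Rational as ℚ
open import Data.Rational.Properties using (+-*-commutativeRing)
open import Data.Product using (∃-syntax; _×_)
open import Algebra.Module.Bundles using (Module)

ℚring = +-*-commutativeRing

-- A ℚ-vector space (ℚ-module).  ℂ is the intended instance.
QVecSpace : (m ℓm : Level) → Set _
QVecSpace m ℓm = Module ℚring m ℓm

UnitIn : ℕ → ℕ → Set
UnitIn d j = (1 ≤ j × j ≤ d) × Coprime j d

module _ {m ℓm : Level} (V : QVecSpace m ℓm) (e : Module.Carrierᴹ V) where
  open Module V

  -- x lies in the copy ℤ·e of the integers (e plays the role of 1 ∈ ℂ)
  IsInt : Carrierᴹ → Set _
  IsInt x = ∃[ n ] (x ≈ᴹ ((n ℚ./ 1) *ₗ e))

  sumᴹ : (k : ℕ) → (Fin k → Carrierᴹ) → Carrierᴹ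
  sumᴹ zero    x = 0ᴹ
  sumᴹ (suc k) x = x Fin.zero +ᴹ sumᴹ k (λ i → x (Fin.suc i))

sumℕ : (k : ℕ) → (Fin k → ℕ) → ℕ
sumℕ zero    j = 0
sumℕ (suc k) j = j Fin.zero ℕ.+ sumℕ k (λ i → j (Fin.suc i))

{-# OPTIONS --safe #-}
module Submission where

-- Work in the quotient V/ℤe, where the hypothesis says that z vanishes on every sum of at most six
-- units that is 0 mod d. Since z(d - a) = -z(a), this lets us compare two such sums of total length at
-- most six whenever they are congruent mod d. Every even residue 2k is a sum a + b of two units
-- (a = k + t, b = k - t with t the part of d coprime to k), and comparing a + b with a' + b' + 1 + 1
-- for a pair summing to 2(k - 1) shows z(a) + z(b) = 2k z(1) by induction on k. The pair (1, d - 1)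
-- for even d, resp. the triple (1, 1, d - 2) for odd d, then gives d z(1) = 0, after which the pair
-- (1, j) gives z(j) = j z(1) for every unit j. Writing d z(1) = c e yields z(j) - (c j / d) e ∈ ℤe.

open import Defs

module Residues where

  open import Data.Nat.Base
  open import Data.Nat.Properties
  open import Data.Nat.Divisibility
  open import Data.Nat.DivMod hiding (_mod_)
  open import Data.Nat.Coprimality using (Coprime; coprime-divisor; gcd≡1⇒coprime; 1-coprimeTo)
  open import Data.Nat.GCD using (gcd; gcd[m,n]∣m; gcd[m,n]∣n; gcd[m,n]≡0⇒m≡0)
  open import Data.Nat.Induction using (<-wellFounded)
  open import Data.Nat.ListAction using (sum)
  open import Data.Nat.ListAction.Properties using (sum-++)
  open import Data.Nat.Tactic.RingSolver using (solve-∀)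
  open import Data.List.Base using ([]; _∷_; _++_; map; length)
  open import Data.List.Relation.Unary.All using (All; []; _∷_)
  open import Data.Product using (∃-syntax; _×_; _,_)
  open import Data.Sum using (_⊎_; inj₁; inj₂)
  open import Function.Base using (_∘_)
  open import Induction.WellFounded using (Acc; acc)
  open import Relation.Nullary using (yes; no; ¬_; contradiction)
  open import Relation.Binary.PropositionalEquality

  coprimePart : ∀ {n} k → Acc _<_ n → .{{NonZero n}} →
                ∃[ t ] Coprime t k × (∀ {g} → g ∣ n → Coprime g k → g ∣ t)
  coprimePart {n} k (acc rec) with gcd n k ≟ 1
  ... | yes gcd≡1 = n , gcd≡1⇒coprime gcd≡1 , λ g∣n _ → g∣n
  ... | no gcd≢1 =
    let t , t⊥k , maximal = coprimePart k (rec (quotient-< gcd∣n))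
    in  t , t⊥k , λ g∣n g⊥k → maximal (g∣q g∣n g⊥k) g⊥k
    where
    gcd∣n = gcd[m,n]∣m n k
    open _∣_ gcd∣n renaming (quotient to q; equality to n≡q*gcd)
    instance
      _ = quotient≢0 gcd∣n
      _ = n>1⇒nonTrivial (≤∧≢⇒< (n≢0⇒n>0 λ gcd≡0 → ≢-nonZero⁻¹ n (gcd[m,n]≡0⇒m≡0 gcd≡0))
                                (λ 1≡gcd → gcd≢1 (sym 1≡gcd)))
    g∣q : ∀ {g} → g ∣ n → Coprime g k → g ∣ q
    g∣q g∣n g⊥k = coprime-divisor (λ (i∣g , i∣gcd) → g⊥k (i∣g , ∣-trans i∣gcd (gcd[m,n]∣n n k)))
                                  (subst (_ ∣_) (trans n≡q*gcd (*-comm q _)) g∣n)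

  +-coprimeTo : ∀ {k s D} → (∀ {i} → i ∣ D → i ∣ k → i ∣ s → i ≡ 1) →
                (∀ {g} → g ∣ D → Coprime g k → g ∣ s) → Coprime (k + s) D
  +-coprimeTo {k} {s} separated covered {g} (g∣k+s , g∣D) = g⊥k (∣-refl , g∣k)
    where
    g⊥k : Coprime g k
    g⊥k {i} (i∣g , i∣k) = separated (∣-trans i∣g g∣D) i∣k (∣m+n∣m⇒∣n (∣-trans i∣g g∣k+s) i∣k)
    g∣k : g ∣ k
    g∣k = ∣m+n∣m⇒∣n (subst (g ∣_) (+-comm k s) g∣k+s) (covered g∣D g⊥k)

  -- t is the part of D = suc m coprime to k, so every prime factor of D divides exactly one of k and t,
  -- and likewise of k and -t ≡ m t (mod D).
  coprime-shifts : ∀ m k → ∃[ t ] Coprime (k + t) (suc m) × Coprime (k + m * t) (suc m)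
  coprime-shifts m k =
    let t , t⊥k , maximal = coprimePart k (<-wellFounded (suc m))
    in  t , +-coprimeTo (λ _ i∣k i∣t → t⊥k (i∣t , i∣k)) maximal
          , +-coprimeTo (λ i∣D i∣k i∣mt → t⊥k (∣m*t⇒∣t i∣D i∣mt , i∣k))
                        (λ g∣D g⊥k → ∣n⇒∣m*n m (maximal g∣D g⊥k))
    where
    ∣m*t⇒∣t : ∀ {i t} → i ∣ suc m → i ∣ m * t → i ∣ t
    ∣m*t⇒∣t {i} {t} i∣D i∣mt = ∣m+n∣m⇒∣n (subst (i ∣_) (+-comm t (m * t)) (∣m⇒∣m*n t i∣D)) i∣mt

  infix 4 _≡_mod_
  _≡_mod_ : ℕ → ℕ → (n : ℕ) → .{{NonZero n}} → Set
  _≡_mod_ a b n = a % n ≡ b % n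

  +-congʳ-mod : ∀ {a b} c {n} .{{_ : NonZero n}} → a ≡ b mod n → a + c ≡ b + c mod n
  +-congʳ-mod {a} {b} c {n} a≡b = begin
    (a + c) % n           ≡⟨ %-distribˡ-+ a c n ⟩
    (a % n + c % n) % n   ≡⟨ cong (λ x → (x + c % n) % n) a≡b ⟩
    (b % n + c % n) % n   ≡⟨ %-distribˡ-+ b c n ⟨
    (b + c) % n           ∎
    where open ≡-Reasoning

  2*k+2≡2*[1+k] : ∀ k → 2 * k + 2 ≡ 2 * suc k
  2*k+2≡2*[1+k] k = trans (+-comm (2 * k) 2) (sym (*-suc 2 k))

  pair≡pair+1+1 : ∀ {a b a′ b′ n} .{{_ : NonZero n}} k → a + b ≡ 2 * suc k mod n → a′ + b′ ≡ 2 * k mod n →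
                  sum (a ∷ b ∷ []) ≡ sum (a′ ∷ b′ ∷ 1 ∷ 1 ∷ []) mod n
  pair≡pair+1+1 {a} {b} {a′} {b′} {n} k a+b≡2k+2 a′+b′≡2k = begin
    (a + (b + 0)) % n    ≡⟨ cong (λ x → (a + x) % n) (+-identityʳ b) ⟩
    (a + b) % n          ≡⟨ a+b≡2k+2 ⟩
    (2 * suc k) % n      ≡⟨ cong (_% n) (2*k+2≡2*[1+k] k) ⟨
    (2 * k + 2) % n      ≡⟨ +-congʳ-mod 2 a′+b′≡2k ⟨
    (a′ + b′ + 2) % n    ≡⟨ cong (_% n) (+-assoc a′ b′ 2) ⟩
    (a′ + (b′ + 2)) % n  ∎
    where open ≡-Reasoning

  even-or-odd : ∀ n → ∃[ q ] (n ≡ 2 * q ⊎ n ≡ 1 + 2 * q)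
  even-or-odd zero = 0 , inj₁ refl
  even-or-odd (suc n) with even-or-odd n
  ... | q , inj₁ refl = q , inj₂ refl
  ... | q , inj₂ refl = suc q , inj₁ (sym (*-suc 2 q))

  sum-complements : ∀ {D bs} → All (_≤ D) bs → sum bs + sum (map (D ∸_) bs) ≡ length bs * D
  sum-complements [] = refl
  sum-complements {D} {b ∷ bs} (b≤D ∷ bs≤D) = begin
    (b + sum bs) + ((D ∸ b) + sum (map (D ∸_) bs))   ≡⟨ +-interchange b (sum bs) (D ∸ b) _ ⟩
    (b + (D ∸ b)) + (sum bs + sum (map (D ∸_) bs))   ≡⟨ cong₂ _+_ (m+[n∸m]≡n b≤D) (sum-complements bs≤D) ⟩
    D + length bs * D                                ∎
    where
    open ≡-Reasoning
    +-interchange : ∀ a b c d → (a + b) + (c + d) ≡ (a + c) + (b + d)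
    +-interchange = solve-∀

  ∣sum-++-complements : ∀ {D} .{{_ : NonZero D}} as {bs} → All (_≤ D) bs → sum as ≡ sum bs mod D →
                        D ∣ sum (as ++ map (D ∸_) bs)
  ∣sum-++-complements {D} as {bs} bs≤D as≡bs = m%n≡0⇒n∣m _ D (begin
    sum (as ++ cs) % D      ≡⟨ cong (_% D) (sum-++ as cs) ⟩
    (sum as + sum cs) % D   ≡⟨ +-congʳ-mod (sum cs) as≡bs ⟩
    (sum bs + sum cs) % D   ≡⟨ cong (_% D) (sum-complements bs≤D) ⟩
    (length bs * D) % D     ≡⟨ m*n%n≡0 (length bs) D ⟩
    0                       ∎)
    where
    open ≡-Reasoning
    cs = map (D ∸_) bs

  -- Writing the modulus as 2 + n makes D ∸ 1 and D ∸ 2 compute.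
  module Modulus (n : ℕ) where

    D : ℕ
    D = 2 + n

    Unit : ℕ → Set
    Unit = UnitIn D

    unit-1 : Unit 1
    unit-1 = (≤-refl , s≤s z≤n) , 1-coprimeTo D

    -- D + 0 is how D appears as the sum of 1 ∷ D ∸ 1 ∷ [] and of 1 ∷ 1 ∷ D ∸ 2 ∷ [].
    D∣D+0 : D ∣ D + 0
    D∣D+0 = ∣-reflexive (sym (+-identityʳ D))

    D∤unit : ∀ {x} → Coprime x D → ¬ D ∣ x
    D∤unit x⊥D D∣x with x⊥D (D∣x , ∣-refl)
    ... | ()

    %-unit : ∀ {x} → Coprime x D → Unit (x % D)
    %-unit {x} x⊥D = (n≢0⇒n>0 (D∤unit x⊥D ∘ m%n≡0⇒n∣m x D) , <⇒≤ (m%n<n x D))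
                   , λ (i∣x%D , i∣D) → x⊥D (∣n∣m%n⇒∣m i∣D i∣x%D , i∣D)

    complement-unit : ∀ {a} → Unit a → Unit (D ∸ a)
    complement-unit {a} ((_ , a≤D) , a⊥D) =
      (m<n⇒0<n∸m a<D , m∸n≤m D a) , λ (i∣D∸a , i∣D) → a⊥D (i∣a i∣D∸a i∣D , i∣D)
      where
      a<D : a < D
      a<D = ≤∧≢⇒< a≤D λ { refl → D∤unit a⊥D ∣-refl }
      i∣a : ∀ {i} → i ∣ D ∸ a → i ∣ D → i ∣ a
      i∣a {i} i∣D∸a i∣D = ∣m+n∣m⇒∣n (subst (i ∣_) (sym (m∸n+n≡m a≤D)) i∣D) i∣D∸a

    units-summing-to-even : ∀ k → ∃[ a ] ∃[ b ] Unit a × Unit b × a + b ≡ 2 * k mod D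
    units-summing-to-even k =
      let t , k+t⊥D , k-t⊥D = coprime-shifts (suc n) k
      in  (k + t) % D , (k + suc n * t) % D , %-unit k+t⊥D , %-unit k-t⊥D , (begin
        ((k + t) % D + (k + suc n * t) % D) % D  ≡⟨ %-distribˡ-+ (k + t) _ D ⟨
        ((k + t) + (k + suc n * t)) % D          ≡⟨ cong (_% D) (sum-shifts k t) ⟩
        (2 * k + t * D) % D                      ≡⟨ [m+kn]%n≡m%n (2 * k) t D ⟩
        (2 * k) % D                              ∎)
      where
      open ≡-Reasoning
      sum-shifts : ∀ k t → (k + t) + (k + suc n * t) ≡ 2 * k + t * D
      sum-shifts = solve-∀

    1+unit-even : ∀ {j} → Unit j → ∃[ k ] 1 + j ≡ 2 * k mod D
    1+unit-even {j} (_ , j⊥D) with even-or-odd j | even-or-odd D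
    ... | q , inj₂ refl | _              = suc q , cong (_% D) (sym (*-suc 2 q))
    ... | q , inj₁ refl | r , inj₁ D≡2r  =
      contradiction (j⊥D (m∣m*n q , subst (2 ∣_) (sym D≡2r) (m∣m*n r))) λ ()
    ... | q , inj₁ refl | r , inj₂ D≡1+2r = suc (q + r) , (begin
      (1 + 2 * q) % D                 ≡⟨ [m+n]%n≡m%n (1 + 2 * q) D ⟨
      (1 + 2 * q + D) % D             ≡⟨ cong (λ d → (1 + 2 * q + d) % D) D≡1+2r ⟩
      (1 + 2 * q + (1 + 2 * r)) % D   ≡⟨ cong (_% D) (sum-of-odds q r) ⟩
      (2 * suc (q + r)) % D           ∎)
      where
      open ≡-Reasoning
      sum-of-odds : ∀ q r → 1 + 2 * q + (1 + 2 * r) ≡ 2 * suc (q + r)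
      sum-of-odds = solve-∀

    odd⇒unit-2 : ∀ {r} → D ≡ 1 + 2 * r → Unit 2
    odd⇒unit-2 {r} D≡1+2r = (s≤s z≤n , s≤s (s≤s z≤n)) , 2⊥D
      where
      2⊥D : Coprime 2 D
      2⊥D {0}                   (0∣2 , _)              = contradiction (0∣⇒≡0 0∣2) λ ()
      2⊥D {1}                   _                      = refl
      2⊥D {2}                   (_ , divides q D≡q*2) =
        contradiction (trans (*-comm 2 q) (trans (sym D≡q*2) D≡1+2r)) (even≢odd q r)
      2⊥D {suc (suc (suc i))}   (i∣2 , _)              = contradiction (∣⇒≤ i∣2) λ { (s≤s (s≤s ())) }

module UnitValues where

  open import Level using (_⊔_)
  open import Algebra.Bundles using (AbelianGroup; Monoid)
  open import Data.Nat.Base using (ℕ; zero; suc; NonZero; _+_; _*_; _∸_; _%_; _/_; _≤_; s≤s; z≤n)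
  open import Data.Nat.Properties
    using (≤ᵇ⇒≤; suc-injective; ≤-refl; ≤-trans; ≤-reflexive; m≤m+n; +-identityʳ; m+[n∸m]≡n)
  open import Data.Nat.Coprimality using (1-coprimeTo)
  open import Data.Nat.Divisibility using (_∣_; ∣-reflexive; ∣-refl)
  open import Data.Nat.DivMod using (m≡m%n+[m/n]*n)
  open import Data.Nat.ListAction using (sum)
  open import Data.List.Base using (List; []; _∷_; _++_; map; length; foldr)
  open import Data.List.Properties using (length-++; length-map)
  open import Data.List.Relation.Unary.All as All using (All; []; _∷_)
  open import Data.List.Relation.Unary.All.Properties using (map⁺; ++⁺)
  open import Data.Product using (_,_)
  open import Data.Sum using (inj₁; inj₂)
  open import Function.Base using (_∘_)
  open import Relation.Binary.Core using (Rel)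
  open import Relation.Binary.Definitions using (_Respects_)
  open import Relation.Binary.PropositionalEquality as ≡ using (_≡_; cong)
  open import Relation.Unary using (Pred)
  open Residues

  record IsSubgroup {a ℓ p} (G : AbelianGroup a ℓ) (P : Pred (AbelianGroup.Carrier G) p) :
                    Set (a ⊔ ℓ ⊔ p) where
    open AbelianGroup G
    field
      resp      : P Respects _≈_
      ε-closed  : P ε
      ∙-closed  : ∀ {x y} → P x → P y → P (x ∙ y)
      ⁻¹-closed : ∀ {x} → P x → P (x ⁻¹)

  module _ {a ℓ p} (G : AbelianGroup a ℓ) {P : Pred (AbelianGroup.Carrier G) p} (H : IsSubgroup G P) where
    open AbelianGroup G
    open IsSubgroup H
    open import Algebra.Properties.AbelianGroup G using (⁻¹-anti-homo‿-; ⁻¹-∙-comm; x≈y⇒x∙y⁻¹≈ε; ε⁻¹≈ε)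
    open import Algebra.Solver.CommutativeMonoid commutativeMonoid using (solve; _⊕_; _⊜_)

    _≈ₕ_ : Rel Carrier p
    x ≈ₕ y = P (x ∙ y ⁻¹)

    ≈⇒≈ₕ : ∀ {x y} → x ≈ y → x ≈ₕ y
    ≈⇒≈ₕ x≈y = resp (sym (x≈y⇒x∙y⁻¹≈ε x≈y)) ε-closed

    ∈⇒≈ₕε : ∀ {x} → P x → x ≈ₕ ε
    ∈⇒≈ₕε {x} = resp (sym (trans (∙-congˡ ε⁻¹≈ε) (identityʳ x)))

    ≈ₕε⇒∈ : ∀ {x} → x ≈ₕ ε → P x
    ≈ₕε⇒∈ {x} = resp (trans (∙-congˡ ε⁻¹≈ε) (identityʳ x))

    quotient : AbelianGroup a p
    quotient = record
      { Carrier = Carrier ; _≈_ = _≈ₕ_ ; _∙_ = _∙_ ; ε = ε ; _⁻¹ = _⁻¹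
      ; isAbelianGroup = record
        { isGroup = record
          { isMonoid = record
            { isSemigroup = record
              { isMagma = record
                { isEquivalence = record
                  { refl  = ≈⇒≈ₕ refl
                  ; sym   = λ {x} {y} → resp (⁻¹-anti-homo‿- x y) ∘ ⁻¹-closed
                  ; trans = λ {x} {y} {z} p q → resp (transitivity x y z) (∙-closed p q) }
                ; ∙-cong = λ {x} {y} {u} {v} p q → resp (interchange x y u v) (∙-closed p q) }
              ; assoc = λ x y z → ≈⇒≈ₕ (assoc x y z) }
            ; identity = ≈⇒≈ₕ ∘ identityˡ , ≈⇒≈ₕ ∘ identityʳ }
          ; inverse = ≈⇒≈ₕ ∘ inverseˡ , ≈⇒≈ₕ ∘ inverseʳ
          ; ⁻¹-cong = λ {x} {y} p → resp (sym (⁻¹-∙-comm x (y ⁻¹))) (⁻¹-closed p) }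
        ; comm = λ x y → ≈⇒≈ₕ (comm x y) } }
      where
      transitivity : ∀ x y z → (x ∙ y ⁻¹) ∙ (y ∙ z ⁻¹) ≈ x ∙ z ⁻¹
      transitivity x y z = trans
        (solve 4 (λ a b c d → (a ⊕ b) ⊕ (c ⊕ d) ⊜ (a ⊕ d) ⊕ (c ⊕ b)) refl x (y ⁻¹) y (z ⁻¹))
        (trans (∙-congˡ (inverseʳ y)) (identityʳ _))
      interchange : ∀ x y u v → (x ∙ y ⁻¹) ∙ (u ∙ v ⁻¹) ≈ (x ∙ u) ∙ (y ∙ v) ⁻¹
      interchange x y u v = trans
        (solve 4 (λ a b c d → (a ⊕ b) ⊕ (c ⊕ d) ⊜ (a ⊕ c) ⊕ (b ⊕ d)) refl x (y ⁻¹) u (v ⁻¹))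
        (∙-congˡ (⁻¹-∙-comm y v))

  module _ {a ℓ} (M : Monoid a ℓ) where
    open Monoid M
    open import Algebra.Properties.Monoid.Mult M using (_×_; ×-congʳ; ×-congˡ; ×-homo-+; ×-assocˡ)
    open import Algebra.Properties.Monoid.Sum M using (sum-replicate; sum-replicate-zero)
    open import Relation.Binary.Reasoning.Setoid setoid

    ×-congˡ-mod : ∀ {d} .{{_ : NonZero d}} {x} → d × x ≈ ε →
                  ∀ {a b} → a ≡ b mod d → a × x ≈ b × x
    ×-congˡ-mod {d} {x} d×x≈ε {a} {b} a≡b = trans (reduce a) (trans (×-congˡ a≡b) (sym (reduce b)))
      where
      ×ε≈ε : ∀ m → m × ε ≈ ε
      ×ε≈ε m = trans (sym (sum-replicate m)) (sum-replicate-zero m)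
      reduce : ∀ a → a × x ≈ (a % d) × x
      reduce a = begin
        a × x                              ≡⟨ ≡.cong (_× x) (m≡m%n+[m/n]*n a d) ⟩
        (a % d + a / d * d) × x            ≈⟨ ×-homo-+ x (a % d) (a / d * d) ⟩
        (a % d) × x ∙ (a / d * d) × x      ≈⟨ ∙-congˡ (×-assocˡ x (a / d) d) ⟨
        (a % d) × x ∙ (a / d) × (d × x)    ≈⟨ ∙-congˡ (×-congʳ (a / d) d×x≈ε) ⟩
        (a % d) × x ∙ (a / d) × ε          ≈⟨ ∙-congˡ (×ε≈ε (a / d)) ⟩
        (a % d) × x ∙ ε                    ≈⟨ identityʳ _ ⟩
        (a % d) × x                        ∎

  module _ {a ℓ} (G : AbelianGroup a ℓ) where
    open AbelianGroup G
    open import Algebra.Properties.Monoid.Mult monoid using (_×_; ×-homo-+)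
    open import Algebra.Properties.Group group using (inverseʳ-unique; ε⁻¹≈ε; x∙y⁻¹≈ε⇒x≈y; ∙-cancelˡ)
    open import Algebra.Properties.AbelianGroup G using (⁻¹-∙-comm)
    open import Relation.Binary.Reasoning.Setoid setoid

    valueSum : (ℕ → Carrier) → List ℕ → Carrier
    valueSum z = foldr (λ j s → z j ∙ s) ε

    valueSum-++ : ∀ z as bs → valueSum z (as ++ bs) ≈ valueSum z as ∙ valueSum z bs
    valueSum-++ z []       bs = sym (identityˡ _)
    valueSum-++ z (j ∷ as) bs = trans (∙-congˡ (valueSum-++ z as bs)) (sym (assoc _ _ _))

    VanishesOnZeroSums : ℕ → (ℕ → Carrier) → Set ℓ
    VanishesOnZeroSums d z = ∀ js → 1 ≤ length js → length js ≤ 6 → All (UnitIn d) js →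
                             d ∣ sum js → valueSum z js ≈ ε

    record LinearOnUnits (d : ℕ) (z : ℕ → Carrier) : Set ℓ where
      field
        period : d × z 1 ≈ ε
        linear : ∀ {j} → UnitIn d j → z j ≈ j × z 1

    module _ (n : ℕ) {z : ℕ → Carrier} (vanishes : VanishesOnZeroSums (2 + n) z) where
      open Modulus n

      z-complement : ∀ {a} → Unit a → z (D ∸ a) ≈ z a ⁻¹
      z-complement {a} ua@((_ , a≤D) , _) = inverseʳ-unique (z a) (z (D ∸ a)) (begin
        z a ∙ z (D ∸ a)                ≈⟨ ∙-congˡ (identityʳ _) ⟨
        valueSum z (a ∷ D ∸ a ∷ [])    ≈⟨ vanishes (a ∷ D ∸ a ∷ []) (s≤s z≤n) (≤ᵇ⇒≤ 2 6 _)
                                            (ua ∷ complement-unit ua ∷ []) D∣a+[D∸a] ⟩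
        ε                              ∎)
        where
        D∣a+[D∸a] : D ∣ a + ((D ∸ a) + 0)
        D∣a+[D∸a] = ∣-reflexive (≡.sym (≡.trans (cong (a +_) (+-identityʳ (D ∸ a))) (m+[n∸m]≡n a≤D)))

      valueSum-complements : ∀ {bs} → All Unit bs →
                             valueSum z (map (D ∸_) bs) ≈ valueSum z bs ⁻¹
      valueSum-complements []                  = sym ε⁻¹≈ε
      valueSum-complements {b ∷ bs} (ub ∷ ubs) = begin
        z (D ∸ b) ∙ valueSum z (map (D ∸_) bs)  ≈⟨ ∙-cong (z-complement ub) (valueSum-complements ubs) ⟩
        z b ⁻¹ ∙ valueSum z bs ⁻¹               ≈⟨ ⁻¹-∙-comm (z b) (valueSum z bs) ⟩
        (z b ∙ valueSum z bs) ⁻¹                ∎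

      valueSum-congruent : ∀ as bs → 1 ≤ length as → length as + length bs ≤ 6 →
                           All Unit as → All Unit bs → sum as ≡ sum bs mod D →
                           valueSum z as ≈ valueSum z bs
      valueSum-congruent as bs 1≤|as| |as|+|bs|≤6 uas ubs as≡bs = x∙y⁻¹≈ε⇒x≈y _ _ (begin
        valueSum z as ∙ valueSum z bs ⁻¹   ≈⟨ ∙-congˡ (valueSum-complements ubs) ⟨
        valueSum z as ∙ valueSum z cs      ≈⟨ valueSum-++ z as cs ⟨
        valueSum z (as ++ cs)              ≈⟨ vanishes (as ++ cs) 1≤|as++cs| |as++cs|≤6 units D∣ ⟩
        ε                                  ∎)
        where
        cs = map (D ∸_) bs
        |as++cs| : length (as ++ cs) ≡ length as + length bs
        |as++cs| = ≡.trans (length-++ as) (cong (length as +_) (length-map (D ∸_) bs))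
        1≤|as++cs| = ≤-trans 1≤|as| (≤-trans (m≤m+n _ _) (≤-reflexive (≡.sym |as++cs|)))
        |as++cs|≤6 = ≤-trans (≤-reflexive |as++cs|) |as|+|bs|≤6
        units = ++⁺ uas (map⁺ (All.map complement-unit ubs))
        D∣ = ∣sum-++-complements as (All.map (λ ((_ , b≤D) , _) → b≤D) ubs) as≡bs

      valueSum-pair : ∀ k {a b} → Unit a → Unit b → a + b ≡ 2 * k mod D →
                      valueSum z (a ∷ b ∷ []) ≈ (2 * k) × z 1
      valueSum-pair zero    {a} {b} ua ub a+b≡0 =
        valueSum-congruent (a ∷ b ∷ []) [] (s≤s z≤n) (≤ᵇ⇒≤ 2 6 _) (ua ∷ ub ∷ []) []
          (≡.trans (cong (λ x → (a + x) % D) (+-identityʳ b)) a+b≡0)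
      valueSum-pair (suc k) {a} {b} ua ub a+b≡2k+2 =
        let a′ , b′ , ua′ , ub′ , a′+b′≡2k = units-summing-to-even k in begin
        valueSum z (a ∷ b ∷ [])               ≈⟨ valueSum-congruent (a ∷ b ∷ []) (a′ ∷ b′ ∷ 1 ∷ 1 ∷ [])
                                                   (s≤s z≤n) ≤-refl (ua ∷ ub ∷ [])
                                                   (ua′ ∷ ub′ ∷ unit-1 ∷ unit-1 ∷ [])
                                                   (pair≡pair+1+1 {a} {b} {a′} {b′} k a+b≡2k+2 a′+b′≡2k) ⟩
        valueSum z (a′ ∷ b′ ∷ 1 ∷ 1 ∷ [])     ≈⟨ valueSum-++ z (a′ ∷ b′ ∷ []) (1 ∷ 1 ∷ []) ⟩
        valueSum z (a′ ∷ b′ ∷ []) ∙ 2 × z 1   ≈⟨ ∙-congʳ (valueSum-pair k ua′ ub′ a′+b′≡2k) ⟩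
        (2 * k) × z 1 ∙ 2 × z 1               ≈⟨ ×-homo-+ (z 1) (2 * k) 2 ⟨
        (2 * k + 2) × z 1                     ≡⟨ cong (_× z 1) (2*k+2≡2*[1+k] k) ⟩
        (2 * suc k) × z 1                     ∎

      D×z₁≈ε : D × z 1 ≈ ε
      D×z₁≈ε with even-or-odd D
      ... | r , inj₁ D≡2r = begin
        D × z 1                           ≡⟨ cong (_× z 1) D≡2r ⟩
        (2 * r) × z 1                     ≈⟨ valueSum-pair r unit-1 u (cong (_% D) D≡2r) ⟨
        valueSum z (1 ∷ D ∸ 1 ∷ [])       ≈⟨ vanishes (1 ∷ D ∸ 1 ∷ []) (s≤s z≤n) (≤ᵇ⇒≤ 2 6 _)
                                               (unit-1 ∷ u ∷ []) D∣D+0 ⟩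
        ε                                 ∎
        where
        u = complement-unit unit-1
      ... | r , inj₂ D≡1+2r = begin
        D × z 1                           ≡⟨ cong (_× z 1) D≡1+2r ⟩
        z 1 ∙ (2 * r) × z 1               ≈⟨ ∙-congˡ (valueSum-pair r unit-1 u 1+[D∸2]≡2r) ⟨
        valueSum z (1 ∷ 1 ∷ D ∸ 2 ∷ [])   ≈⟨ vanishes (1 ∷ 1 ∷ D ∸ 2 ∷ []) (s≤s z≤n) (≤ᵇ⇒≤ 3 6 _)
                                               (unit-1 ∷ unit-1 ∷ u ∷ []) D∣D+0 ⟩
        ε                                 ∎
        where
        u = complement-unit (odd⇒unit-2 {r} D≡1+2r)
        1+[D∸2]≡2r = cong (_% D) (suc-injective D≡1+2r)

      z-linear : ∀ {j} → Unit j → z j ≈ j × z 1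
      z-linear {j} uj = let k , 1+j≡2k = 1+unit-even uj in
        trans (sym (identityʳ (z j))) (∙-cancelˡ (z 1) _ _ (begin
          valueSum z (1 ∷ j ∷ [])   ≈⟨ valueSum-pair k unit-1 uj 1+j≡2k ⟩
          (2 * k) × z 1             ≈⟨ ×-congˡ-mod monoid D×z₁≈ε {2 * k} {1 + j} (≡.sym 1+j≡2k) ⟩
          (1 + j) × z 1             ∎))

    linearOnUnits : ∀ d .{{_ : NonZero d}} {z} → VanishesOnZeroSums d z → LinearOnUnits d z
    linearOnUnits 1 vanishes = record
      { period = vanishes (1 ∷ []) ≤-refl (≤ᵇ⇒≤ 1 6 _) (unit-1 ∷ []) ∣-refl
      ; linear = λ { ((s≤s z≤n , s≤s z≤n) , _) → sym (identityʳ _) } }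
      where
      unit-1 : UnitIn 1 1
      unit-1 = (≤-refl , ≤-refl) , 1-coprimeTo 1
    linearOnUnits (suc (suc n)) vanishes = record
      { period = D×z₁≈ε n vanishes
      ; linear = z-linear n vanishes }

module ModuloIntegers where

  open import Level using (Level)
  open import Algebra.Bundles using (AbelianGroup)
  open import Algebra.Module.Bundles using (Module)
  open import Data.Nat.Base as ℕ using (ℕ; zero; suc; NonZero)
  open import Data.Nat.Divisibility using (_∣_)
  open import Data.Nat.ListAction using (sum)
  open import Data.Integer.Base as ℤ using (+_)
  open import Data.Integer.Tactic.RingSolver using (solve-∀)
  open import Data.Rational.Base as ℚ using (_/_; toℚᵘ)
  open import Data.Rational.Properties
    using (toℚᵘ-injective; toℚᵘ-fromℚᵘ; toℚᵘ-homo-+; toℚᵘ-homo-*; toℚᵘ-homo‿-; +-inverseˡ)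
  open import Data.Rational.Unnormalised.Base as ℚᵘ using (mkℚᵘ; *≡*)
  import Data.Rational.Unnormalised.Properties as ℚᵘ
  open import Data.Fin.Base using (Fin)
  open import Data.List.Base using ([]; _∷_; length; lookup)
  open import Data.List.Relation.Unary.All as All using ()
  open import Data.List.Membership.Propositional.Properties using (∈-lookup)
  open import Data.Product using (_,_; ∃-syntax)
  open import Relation.Binary.PropositionalEquality as ≡ using (_≡_)
  open UnitValues

  toℚᵘ-/ : ∀ i n → toℚᵘ (i / suc n) ℚᵘ.≃ mkℚᵘ i n
  toℚᵘ-/ i n = toℚᵘ-fromℚᵘ (mkℚᵘ i n)

  /1-homo-+ : ∀ a b → a / 1 ℚ.+ b / 1 ≡ (a ℤ.+ b) / 1
  /1-homo-+ a b = toℚᵘ-injective (begin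
    toℚᵘ (a / 1 ℚ.+ b / 1)           ≈⟨ toℚᵘ-homo-+ (a / 1) (b / 1) ⟩
    toℚᵘ (a / 1) ℚᵘ.+ toℚᵘ (b / 1)   ≈⟨ ℚᵘ.+-cong (toℚᵘ-/ a 0) (toℚᵘ-/ b 0) ⟩
    mkℚᵘ a 0 ℚᵘ.+ mkℚᵘ b 0           ≈⟨ *≡* (ring a b) ⟩
    mkℚᵘ (a ℤ.+ b) 0                 ≈⟨ toℚᵘ-/ (a ℤ.+ b) 0 ⟨
    toℚᵘ ((a ℤ.+ b) / 1)             ∎)
    where
    open ℚᵘ.≃-Reasoning
    ring : ∀ a b → (a ℤ.* + 1 ℤ.+ b ℤ.* + 1) ℤ.* + 1 ≡ (a ℤ.+ b) ℤ.* + 1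
    ring = solve-∀

  /1-homo-neg : ∀ a → ℚ.- (a / 1) ≡ (ℤ.- a) / 1
  /1-homo-neg a = toℚᵘ-injective (begin
    toℚᵘ (ℚ.- (a / 1))   ≈⟨ toℚᵘ-homo‿- (a / 1) ⟩
    ℚᵘ.- toℚᵘ (a / 1)    ≈⟨ ℚᵘ.-‿cong (toℚᵘ-/ a 0) ⟩
    mkℚᵘ (ℤ.- a) 0       ≈⟨ toℚᵘ-/ (ℤ.- a) 0 ⟨
    toℚᵘ ((ℤ.- a) / 1)   ∎)
    where open ℚᵘ.≃-Reasoning

  1/d*d≡1 : ∀ d .{{_ : NonZero d}} → (+ 1 / d) ℚ.* (+ d / 1) ≡ ℚ.1ℚ
  1/d*d≡1 d@(suc n) = toℚᵘ-injective (begin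
    toℚᵘ ((+ 1 / d) ℚ.* (+ d / 1))       ≈⟨ toℚᵘ-homo-* (+ 1 / d) (+ d / 1) ⟩
    toℚᵘ (+ 1 / d) ℚᵘ.* toℚᵘ (+ d / 1)   ≈⟨ ℚᵘ.*-cong (toℚᵘ-/ (+ 1) n) (toℚᵘ-/ (+ d) 0) ⟩
    mkℚᵘ (+ 1) n ℚᵘ.* mkℚᵘ (+ d) 0       ≈⟨ *≡* (ring (+ d)) ⟩
    ℚᵘ.1ℚᵘ                               ∎)
    where
    open ℚᵘ.≃-Reasoning
    ring : ∀ m → (+ 1 ℤ.* m) ℤ.* + 1 ≡ + 1 ℤ.* (m ℤ.* + 1)
    ring = solve-∀

  j*[1/d*c]≡c*j/d : ∀ d .{{_ : NonZero d}} j c → (+ j / 1) ℚ.* ((+ 1 / d) ℚ.* (c / 1)) ≡ (c ℤ.* + j) / d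
  j*[1/d*c]≡c*j/d d@(suc n) j c = toℚᵘ-injective (begin
    toℚᵘ ((+ j / 1) ℚ.* ((+ 1 / d) ℚ.* (c / 1)))             ≈⟨ toℚᵘ-homo-* (+ j / 1) _ ⟩
    toℚᵘ (+ j / 1) ℚᵘ.* toℚᵘ ((+ 1 / d) ℚ.* (c / 1))         ≈⟨ ℚᵘ.*-congˡ {toℚᵘ (+ j / 1)}
                                                                  (toℚᵘ-homo-* (+ 1 / d) (c / 1)) ⟩
    toℚᵘ (+ j / 1) ℚᵘ.* (toℚᵘ (+ 1 / d) ℚᵘ.* toℚᵘ (c / 1))   ≈⟨ ℚᵘ.*-cong (toℚᵘ-/ (+ j) 0)
                                                                  (ℚᵘ.*-cong (toℚᵘ-/ (+ 1) n) (toℚᵘ-/ c 0)) ⟩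
    mkℚᵘ (+ j) 0 ℚᵘ.* (mkℚᵘ (+ 1) n ℚᵘ.* mkℚᵘ c 0)           ≈⟨ *≡* (ring (+ j) c (+ d)) ⟩
    mkℚᵘ (c ℤ.* + j) n                                        ≈⟨ toℚᵘ-/ (c ℤ.* + j) n ⟨
    toℚᵘ ((c ℤ.* + j) / d)                                    ∎)
    where
    open ℚᵘ.≃-Reasoning
    ring : ∀ a b m → (a ℤ.* (+ 1 ℤ.* b)) ℤ.* m ≡ (b ℤ.* a) ℤ.* (+ 1 ℤ.* (m ℤ.* + 1))
    ring = solve-∀

  module _ {mv ℓv : Level} (V : QVecSpace mv ℓv) (e : Module.Carrierᴹ V) where
    open Module V
    open import Algebra.Properties.AbelianGroup +ᴹ-abelianGroup using (inverseˡ-unique)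
    open import Relation.Binary.Reasoning.Setoid ≈ᴹ-setoid

    -‿distribˡ-*ₗ : ∀ r x → (ℚ.- r) *ₗ x ≈ᴹ -ᴹ (r *ₗ x)
    -‿distribˡ-*ₗ r x = inverseˡ-unique ((ℚ.- r) *ₗ x) (r *ₗ x) (begin
      (ℚ.- r) *ₗ x +ᴹ r *ₗ x    ≈⟨ *ₗ-distribʳ x (ℚ.- r) r ⟨
      (ℚ.- r ℚ.+ r) *ₗ x        ≡⟨ ≡.cong (_*ₗ x) (+-inverseˡ r) ⟩
      ℚ.0ℚ *ₗ x                 ≈⟨ *ₗ-zeroˡ x ⟩
      0ᴹ                        ∎)

    integers : IsSubgroup +ᴹ-abelianGroup (IsInt V e)
    integers = record
      { resp      = λ x≈y (a , x≈a) → a , ≈ᴹ-trans (≈ᴹ-sym x≈y) x≈a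
      ; ε-closed  = + 0 , ≈ᴹ-sym (*ₗ-zeroˡ e)
      ; ∙-closed  = λ {x} {y} (a , x≈a) (b , y≈b) → a ℤ.+ b , (begin
          x +ᴹ y                           ≈⟨ +ᴹ-cong x≈a y≈b ⟩
          (a / 1) *ₗ e +ᴹ (b / 1) *ₗ e     ≈⟨ *ₗ-distribʳ e (a / 1) (b / 1) ⟨
          (a / 1 ℚ.+ b / 1) *ₗ e           ≡⟨ ≡.cong (_*ₗ e) (/1-homo-+ a b) ⟩
          ((a ℤ.+ b) / 1) *ₗ e             ∎)
      ; ⁻¹-closed = λ {x} (a , x≈a) → ℤ.- a , (begin
          -ᴹ x                             ≈⟨ -ᴹ‿cong x≈a ⟩
          -ᴹ ((a / 1) *ₗ e)                ≈⟨ -‿distribˡ-*ₗ (a / 1) e ⟨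
          (ℚ.- (a / 1)) *ₗ e               ≡⟨ ≡.cong (_*ₗ e) (/1-homo-neg a) ⟩
          ((ℤ.- a) / 1) *ₗ e               ∎) }

    V/ℤe : AbelianGroup mv _
    V/ℤe = quotient +ᴹ-abelianGroup integers

    open import Algebra.Properties.Monoid.Mult (AbelianGroup.monoid V/ℤe) using (_×_)

    ×≈*ₗ : ∀ k x → k × x ≈ᴹ (+ k / 1) *ₗ x
    ×≈*ₗ zero    x = ≈ᴹ-sym (*ₗ-zeroˡ x)
    ×≈*ₗ (suc k) x = begin
      x +ᴹ k × x                    ≈⟨ +ᴹ-cong (≈ᴹ-sym (*ₗ-identityˡ x)) (×≈*ₗ k x) ⟩
      ℚ.1ℚ *ₗ x +ᴹ (+ k / 1) *ₗ x   ≈⟨ *ₗ-distribʳ x ℚ.1ℚ (+ k / 1) ⟨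
      (ℚ.1ℚ ℚ.+ + k / 1) *ₗ x       ≡⟨ ≡.cong (_*ₗ x) (/1-homo-+ (+ 1) (+ k)) ⟩
      (+ suc k / 1) *ₗ x            ∎

    ×-divide : ∀ d .{{_ : NonZero d}} {x} c j → d × x ≈ᴹ (c / 1) *ₗ e →
               j × x ≈ᴹ ((c ℤ.* + j) / d) *ₗ e
    ×-divide d {x} c j d×x≈c = begin
      j × x                                          ≈⟨ ×≈*ₗ j x ⟩
      (+ j / 1) *ₗ x                                 ≈⟨ *ₗ-congˡ x≈c/d ⟩
      (+ j / 1) *ₗ (((+ 1 / d) ℚ.* (c / 1)) *ₗ e)    ≈⟨ *ₗ-assoc (+ j / 1) _ e ⟨
      ((+ j / 1) ℚ.* ((+ 1 / d) ℚ.* (c / 1))) *ₗ e   ≡⟨ ≡.cong (_*ₗ e) (j*[1/d*c]≡c*j/d d j c) ⟩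
      ((c ℤ.* + j) / d) *ₗ e                         ∎
      where
      x≈c/d : x ≈ᴹ ((+ 1 / d) ℚ.* (c / 1)) *ₗ e
      x≈c/d = begin
        x                                ≈⟨ *ₗ-identityˡ x ⟨
        ℚ.1ℚ *ₗ x                        ≡⟨ ≡.cong (_*ₗ x) (1/d*d≡1 d) ⟨
        ((+ 1 / d) ℚ.* (+ d / 1)) *ₗ x   ≈⟨ *ₗ-assoc (+ 1 / d) (+ d / 1) x ⟩
        (+ 1 / d) *ₗ ((+ d / 1) *ₗ x)    ≈⟨ *ₗ-congˡ (≈ᴹ-trans (≈ᴹ-sym (×≈*ₗ d x)) d×x≈c) ⟩
        (+ 1 / d) *ₗ ((c / 1) *ₗ e)      ≈⟨ *ₗ-assoc (+ 1 / d) (c / 1) e ⟨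
        ((+ 1 / d) ℚ.* (c / 1)) *ₗ e     ∎

    IntegralOnZeroSumTuples : ℕ → (ℕ → Carrierᴹ) → Set _
    IntegralOnZeroSumTuples d z =
      ∀ m → 1 ℕ.≤ m → m ℕ.≤ 6 → (js : Fin m → ℕ) → (∀ i → UnitIn d (js i)) →
      d ∣ sumℕ m js → IsInt V e (sumᴹ V e m (λ i → z (js i)))

    vanishesOnZeroSums : ∀ d {z} → IntegralOnZeroSumTuples d z → VanishesOnZeroSums V/ℤe d z
    vanishesOnZeroSums d {z} integral js 1≤|js| |js|≤6 units d∣Σjs =
      ∈⇒≈ₕε +ᴹ-abelianGroup integers (≡.subst (IsInt V e) (sumᴹ-lookup js)
        (integral (length js) 1≤|js| |js|≤6 (lookup js) (λ i → All.lookup units (∈-lookup i))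
                  (≡.subst (d ∣_) (≡.sym (sumℕ-lookup js)) d∣Σjs)))
      where
      sumᴹ-lookup : ∀ js → sumᴹ V e (length js) (λ i → z (lookup js i)) ≡ valueSum V/ℤe z js
      sumᴹ-lookup []       = ≡.refl
      sumᴹ-lookup (j ∷ js) = ≡.cong (z j +ᴹ_) (sumᴹ-lookup js)
      sumℕ-lookup : ∀ js → sumℕ (length js) (lookup js) ≡ sum js
      sumℕ-lookup []       = ≡.refl
      sumℕ-lookup (j ∷ js) = ≡.cong (j ℕ.+_) (sumℕ-lookup js)

    integral-after-shift : ∀ d .{{_ : NonZero d}} {z} → LinearOnUnits V/ℤe d z →
                           ∃[ c ] (∀ j → UnitIn d j → IsInt V e (z j +ᴹ -ᴹ (((c ℤ.* + j) / d) *ₗ e)))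
    integral-after-shift d {z} linearOnUnits =
      let c , d×z₁≈c = ≈ₕε⇒∈ +ᴹ-abelianGroup integers period
      in  c , λ j j-unit →
            IsSubgroup.resp integers (+ᴹ-congˡ (-ᴹ‿cong (×-divide d c j d×z₁≈c))) (linear j-unit)
      where open LinearOnUnits linearOnUnits

open import Level using (Level)
open import Data.Nat using (ℕ; _≤_; NonZero)
open import Data.Nat.Divisibility using (_∣_)
open import Data.Fin using (Fin)
open import Data.Integer using (+_; _*_)
open import Data.Rational using (_/_)
open import Data.Product using (∃-syntax)
open import Relation.Nullary using (¬_)
open import Algebra.Module.Bundles using (Module)
open UnitValues using (linearOnUnits)
open ModuloIntegers

-- The proof works in V/ℤe for every e.
lemma3p8 : {mv ℓv : Level} (V : QVecSpace mv ℓv) (e : Module.Carrierᴹ V)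
  → ¬ (Module._≈ᴹ_ V e (Module.0ᴹ V))
  → (d : ℕ) .{{_ : NonZero d}}
  → (z : ℕ → Module.Carrierᴹ V)
  → (∀ (m : ℕ) → 1 ≤ m → m ≤ 6 → (js : Fin m → ℕ)
       → (∀ i → UnitIn d (js i))
       → d ∣ sumℕ m js
       → IsInt V e (sumᴹ V e m (λ i → z (js i))))
  → ∃[ c ] (∀ (j : ℕ) → UnitIn d j
       → IsInt V e (Module._+ᴹ_ V (z j)
            (Module.-ᴹ_ V (Module._*ₗ_ V ((c * + j) / d) e))))
lemma3p8 V e _ d z integral =
  integral-after-shift V e d (linearOnUnits (V/ℤe V e) d (vanishesOnZeroSums V e d integral))
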